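{- Let $\mathcal{P}$ be an orientably-regular polyhedron of type $\{p,q\}$ with $p$ odd, whose automorphism group $\Gamma(\mathcal{P})$ is generated by the reflections $\rho_0,\rho_1,\rho_2$ with respect to a base flag, and let $\Gamma^+(\mathcal{P})=\langle \rho_0\rho_1,\rho_1\rho_2\rangle$ be its rotation subgroup. If $\omega=(\rho_1\rho_2)^2$ generates a normal subgroup of $\Gamma^+(\mathcal{P})$, then $\omega$ is central in $\Gamma^+(\mathcal{P})$, and $q$ divides $2p$.
   Context: A polyhedron is an abstract polytope of rank $3$ (a ranked poset with ranks $-1$ to $3$, unique least and greatest faces, flags of $5$ faces, connected sections, and the diamond condition). It has type $\{p,q\}$ if every $2$-face is a $p$-gon and every vertex-figure a $q$-gon. It is regular if its automorphism group acts transitively on flags; then for a base flag $\Phi$, $\rho_i$ denotes the automorphism mapping $\Phi$ to the flag differing from $\Phi$ only in its $i$-face, and $\rho_0\rho_1$, $\rho_1\rho_2$ have orders $p$, $q$, while $(\rho_0\rho_2)^2=1$. It is orientably-regular if $\Gamma^+(\mathcal{P})$ has index $2$ in $\Gamma(\mathcal{P})$. -}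

module Defs where

open import Level using (Level; _⊔_)
open import Algebra.Bundles using (Group)
open import Data.Nat using (ℕ; zero; suc; _≤_; _<_)
open import Data.List using (List; []; _∷_)
open import Data.List.Relation.Unary.Any using (Any)
open import Data.Product using (Σ; ∃; _×_; _,_)
open import Data.Sum using (_⊎_)
open import Relation.Nullary using (¬_)

module GroupNotions {c ℓ : Level} (G : Group c ℓ) where
  open Group G

  pow : Carrier → ℕ → Carrier
  pow g zero    = ε
  pow g (suc n) = g ∙ pow g n

  HasOrder : Carrier → ℕ → Set ℓ
  HasOrder g n = (1 ≤ n) × (pow g n ≈ ε) × (∀ m → 1 ≤ m → m < n → ¬ (pow g m ≈ ε))

  data ⟨_⟩ (xs : List Carrier) : Carrier → Set (c ⊔ ℓ) where
    gen  : ∀ {x} → Any (x ≈_) xs → ⟨ xs ⟩ x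
    unit : ⟨ xs ⟩ ε
    mul  : ∀ {x y} → ⟨ xs ⟩ x → ⟨ xs ⟩ y → ⟨ xs ⟩ (x ∙ y)
    inv  : ∀ {x} → ⟨ xs ⟩ x → ⟨ xs ⟩ (x ⁻¹)
    resp : ∀ {x y} → x ≈ y → ⟨ xs ⟩ x → ⟨ xs ⟩ y

  Index2 : (Carrier → Set (c ⊔ ℓ)) → Set (c ⊔ ℓ)
  Index2 H = Σ Carrier λ t → ¬ H t × (∀ g → H g ⊎ H (g ∙ t ⁻¹))

  -- Γ is a string C-group of rank 3 generated by ρ0 ρ1 ρ2 with type {p,q}
  -- (i.e. Γ is the automorphism group of a regular polyhedron of type {p,q},
  -- the ρi being the distinguished generators w.r.t. a base flag)
  record RegularPolyhedronGroup (p q : ℕ) (ρ₀ ρ₁ ρ₂ : Carrier) : Set (c ⊔ ℓ) where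
    field
      generates     : ∀ g → ⟨ ρ₀ ∷ ρ₁ ∷ ρ₂ ∷ [] ⟩ g
      ρ₀-invol      : HasOrder ρ₀ 2
      ρ₁-invol      : HasOrder ρ₁ 2
      ρ₂-invol      : HasOrder ρ₂ 2
      p≥2           : 2 ≤ p
      q≥2           : 2 ≤ q
      order-ρ₀ρ₁    : HasOrder (ρ₀ ∙ ρ₁) p
      order-ρ₁ρ₂    : HasOrder (ρ₁ ∙ ρ₂) q
      ρ₀ρ₂-square   : pow (ρ₀ ∙ ρ₂) 2 ≈ ε
      intersection  : ∀ g → ⟨ ρ₀ ∷ ρ₁ ∷ [] ⟩ g → ⟨ ρ₁ ∷ ρ₂ ∷ [] ⟩ g → ⟨ ρ₁ ∷ [] ⟩ g

  Γ⁺ : (ρ₀ ρ₁ ρ₂ : Carrier) → Carrier → Set (c ⊔ ℓ)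
  Γ⁺ ρ₀ ρ₁ ρ₂ = ⟨ (ρ₀ ∙ ρ₁) ∷ (ρ₁ ∙ ρ₂) ∷ [] ⟩

  NormalIn : Carrier → (Carrier → Set (c ⊔ ℓ)) → Set (c ⊔ ℓ)
  NormalIn ω H = ∀ h x → H h → ⟨ ω ∷ [] ⟩ x → ⟨ ω ∷ [] ⟩ (h ∙ x ∙ h ⁻¹)

  CentralIn : Carrier → (Carrier → Set (c ⊔ ℓ)) → Set (c ⊔ ℓ)
  CentralIn ω H = ∀ h → H h → h ∙ ω ≈ ω ∙ h

{-# OPTIONS --safe #-}
-- Write a = ρ₀ρ₁, b = ρ₁ρ₂ and ω = b².  Conjugation by ρ₁ inverts a and b, hence ω, hence
-- every element of the cyclic group ⟨ω⟩, in particular a ω a⁻¹ ∈ ⟨ω⟩.  Computing the image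
-- of a ω a⁻¹ in two ways gives a⁻¹ ω⁻¹ a = a ω⁻¹ a⁻¹, i.e. a² commutes with ω; as a has odd
-- order p it is a power of a², so ω commutes with both generators a and b of Γ⁺.
-- Since ρ₀ and ρ₂ commute, ωa = b (ρ₁ a ρ₁) b⁻¹ is a conjugate of a, so
-- 1 = (ωa)ᵖ = ωᵖ aᵖ = ωᵖ = b²ᵖ and the order q of b divides 2p.
module Submission where

open import Defs
open import Algebra.Bundles using (Group)
open import Data.Nat using (ℕ; zero; suc; _+_; _*_; _<_; _%_; _/_; z≤n; s≤s)
open import Data.Nat.Properties using (*-comm)
open import Data.Nat.DivMod using (m≡m%n+[m/n]*n; m%n<n)
open import Data.Nat.Divisibility using (_∣_; divides; ∣-refl; ∣m∣n⇒∣m+n; m%n≡0⇒n∣m)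
open import Data.List using (List; []; _∷_)
open import Data.List.Relation.Unary.Any using (Any; here; there)
open import Data.Product using (_×_; ∃-syntax; _,_; proj₁; proj₂)
open import Function using (_∘_)
open import Relation.Nullary using (¬_; contradiction)
open import Relation.Binary.PropositionalEquality as ≡ using (_≡_)
open import Tactic.MonoidSolver using (solve)

¬2∣⇒odd : ∀ {n} → ¬ (2 ∣ n) → ∃[ k ] n ≡ suc (k * 2)
¬2∣⇒odd {zero}        ¬2∣n = contradiction (divides 0 ≡.refl) ¬2∣n
¬2∣⇒odd {suc zero}    ¬2∣n = 0 , ≡.refl
¬2∣⇒odd {suc (suc n)} ¬2∣n with ¬2∣⇒odd {n} (¬2∣n ∘ ∣m∣n⇒∣m+n ∣-refl)
... | k , ≡.refl = suc k , ≡.refl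

module GroupTheory {c ℓ} (G : Group c ℓ) where
  open Group G
  open GroupNotions G
  open import Algebra.Properties.Group G using (inverseˡ-unique; inverseʳ-unique; ε⁻¹≈ε; ⁻¹-involutive; ⁻¹-anti-homo-∙)
  open import Relation.Binary.Reasoning.Setoid setoid

  private variable
    w x y z g : Carrier
    m p q : ℕ
    ys : List Carrier

  pow-cong : ∀ n → x ≈ y → pow x n ≈ pow y n
  pow-cong zero    x≈y = refl
  pow-cong (suc n) x≈y = ∙-cong x≈y (pow-cong n x≈y)

  pow-ε : ∀ n → pow ε n ≈ ε
  pow-ε zero    = refl
  pow-ε (suc n) = trans (identityˡ _) (pow-ε n)

  pow-+ : ∀ x m n → pow x (m + n) ≈ pow x m ∙ pow x n
  pow-+ x zero    n = sym (identityˡ _)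
  pow-+ x (suc m) n = trans (∙-congˡ (pow-+ x m n)) (sym (assoc _ _ _))

  pow-* : ∀ x m n → pow (pow x n) m ≈ pow x (m * n)
  pow-* x zero    n = refl
  pow-* x (suc m) n = trans (∙-congˡ (pow-* x m n)) (sym (pow-+ x n (m * n)))

  pow-∈ : ∀ n → ⟨ x ∷ [] ⟩ (pow x n)
  pow-∈ zero    = unit
  pow-∈ (suc n) = mul (gen (here refl)) (pow-∈ n)

  order-∣ : HasOrder g q → pow g m ≈ ε → q ∣ m
  order-∣ {g} {suc q} {m} (_ , gq≈ε , minimal) gm≈ε with m % suc q in r≡
  ... | zero  = m%n≡0⇒n∣m m (suc q) r≡
  ... | suc r = contradiction gʳ≈ε (minimal (suc r) (s≤s z≤n) (≡.subst (_< suc q) r≡ (m%n<n m (suc q))))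
    where
    k : ℕ
    k = m / suc q

    gʳ≈ε : pow g (suc r) ≈ ε
    gʳ≈ε = begin
      pow g (suc r)                          ≈⟨ identityʳ _ ⟨
      pow g (suc r) ∙ ε                      ≈⟨ ∙-congˡ (trans (pow-cong k gq≈ε) (pow-ε k)) ⟨
      pow g (suc r) ∙ pow (pow g (suc q)) k  ≈⟨ ∙-congˡ (pow-* g k (suc q)) ⟩
      pow g (suc r) ∙ pow g (k * suc q)      ≈⟨ pow-+ g (suc r) (k * suc q) ⟨
      pow g (suc r + k * suc q)              ≡⟨ ≡.cong (λ r → pow g (r + k * suc q)) r≡ ⟨
      pow g (m % suc q + k * suc q)          ≡⟨ ≡.cong (pow g) (m≡m%n+[m/n]*n m (suc q)) ⟨
      pow g m                                ≈⟨ gm≈ε ⟩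
      ε                                      ∎

  Commute : Carrier → Carrier → Set ℓ
  Commute x y = x ∙ y ≈ y ∙ x

  commute-respˡ : x ≈ y → Commute x z → Commute y z
  commute-respˡ x≈y xz≈zx = trans (∙-congʳ (sym x≈y)) (trans xz≈zx (∙-congˡ x≈y))

  commute-εˡ : ∀ x → Commute ε x
  commute-εˡ x = trans (identityˡ x) (sym (identityʳ x))

  commute-∙ˡ : Commute x z → Commute y z → Commute (x ∙ y) z
  commute-∙ˡ {x} {z} {y} xz≈zx yz≈zy = begin
    x ∙ y ∙ z   ≈⟨ assoc x y z ⟩
    x ∙ (y ∙ z) ≈⟨ ∙-congˡ yz≈zy ⟩
    x ∙ (z ∙ y) ≈⟨ assoc x z y ⟨
    x ∙ z ∙ y   ≈⟨ ∙-congʳ xz≈zx ⟩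
    z ∙ x ∙ y   ≈⟨ assoc z x y ⟩
    z ∙ (x ∙ y) ∎

  commute-⁻¹ˡ : Commute x z → Commute (x ⁻¹) z
  commute-⁻¹ˡ {x} {z} xz≈zx = begin
    x ⁻¹ ∙ z                   ≈⟨ identityʳ _ ⟨
    x ⁻¹ ∙ z ∙ ε               ≈⟨ ∙-congˡ (inverseʳ x) ⟨
    x ⁻¹ ∙ z ∙ (x ∙ x ⁻¹)      ≈⟨ solve monoid ⟩
    x ⁻¹ ∙ (z ∙ x) ∙ x ⁻¹      ≈⟨ ∙-congʳ (∙-congˡ xz≈zx) ⟨
    x ⁻¹ ∙ (x ∙ z) ∙ x ⁻¹      ≈⟨ solve monoid ⟩
    (x ⁻¹ ∙ x) ∙ z ∙ x ⁻¹      ≈⟨ ∙-congʳ (∙-congʳ (inverseˡ x)) ⟩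
    ε ∙ z ∙ x ⁻¹               ≈⟨ ∙-congʳ (identityˡ z) ⟩
    z ∙ x ⁻¹                   ∎

  commute-⟨⟩ˡ : (∀ {y} → Any (y ≈_) ys → Commute y z) → ⟨ ys ⟩ x → Commute x z
  commute-⟨⟩ˡ gens (gen y∈ys)   = gens y∈ys
  commute-⟨⟩ˡ gens unit         = commute-εˡ _
  commute-⟨⟩ˡ gens (mul x∈ y∈)  = commute-∙ˡ (commute-⟨⟩ˡ gens x∈) (commute-⟨⟩ˡ gens y∈)
  commute-⟨⟩ˡ gens (inv x∈)     = commute-⁻¹ˡ (commute-⟨⟩ˡ gens x∈)
  commute-⟨⟩ˡ gens (resp x≈y x∈) = commute-respˡ x≈y (commute-⟨⟩ˡ gens x∈)

  commute-cyclicˡ : Commute w z → ⟨ w ∷ [] ⟩ x → Commute x z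
  commute-cyclicˡ wz≈zw = commute-⟨⟩ˡ λ { (here v≈w) → commute-respˡ (sym v≈w) wz≈zw ; (there ()) }

  commute-powˡ : ∀ n → Commute x z → Commute (pow x n) z
  commute-powˡ n xz≈zx = commute-cyclicˡ xz≈zx (pow-∈ n)

  ⟨⟩-commute : ⟨ w ∷ [] ⟩ x → ⟨ w ∷ [] ⟩ y → Commute x y
  ⟨⟩-commute x∈ y∈ = commute-cyclicˡ (sym (commute-cyclicˡ refl y∈)) x∈

  pow-∙ : ∀ n → Commute x y → pow (x ∙ y) n ≈ pow x n ∙ pow y n
  pow-∙ zero    xy≈yx = sym (identityˡ ε)
  pow-∙ {x} {y} (suc n) xy≈yx = begin
    x ∙ y ∙ pow (x ∙ y) n       ≈⟨ ∙-congˡ (pow-∙ n xy≈yx) ⟩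
    x ∙ y ∙ (pow x n ∙ pow y n) ≈⟨ solve monoid ⟩
    x ∙ (y ∙ pow x n) ∙ pow y n ≈⟨ ∙-congʳ (∙-congˡ (commute-powˡ n xy≈yx)) ⟨
    x ∙ (pow x n ∙ y) ∙ pow y n ≈⟨ solve monoid ⟩
    x ∙ pow x n ∙ (y ∙ pow y n) ∎

  conj : Carrier → Carrier → Carrier
  conj g x = g ∙ x ∙ g ⁻¹

  conj-cong : ∀ {g h} → g ≈ h → x ≈ y → conj g x ≈ conj h y
  conj-cong g≈h x≈y = ∙-cong (∙-cong g≈h x≈y) (⁻¹-cong g≈h)

  conj-ε : ∀ g → conj g ε ≈ ε
  conj-ε g = trans (∙-congʳ (identityʳ g)) (inverseʳ g)

  conj-∙ : ∀ g x y → conj g (x ∙ y) ≈ conj g x ∙ conj g y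
  conj-∙ g x y = begin
    g ∙ (x ∙ y) ∙ g ⁻¹                ≈⟨ solve monoid ⟩
    g ∙ x ∙ ε ∙ y ∙ g ⁻¹              ≈⟨ ∙-congʳ (∙-congʳ (∙-congˡ (inverseˡ g))) ⟨
    g ∙ x ∙ (g ⁻¹ ∙ g) ∙ y ∙ g ⁻¹     ≈⟨ solve monoid ⟩
    (g ∙ x ∙ g ⁻¹) ∙ (g ∙ y ∙ g ⁻¹)   ∎

  conj-⁻¹ : ∀ g x → conj g (x ⁻¹) ≈ conj g x ⁻¹
  conj-⁻¹ g x = inverseˡ-unique _ _ (begin
    conj g (x ⁻¹) ∙ conj g x ≈⟨ conj-∙ g (x ⁻¹) x ⟨
    conj g (x ⁻¹ ∙ x)        ≈⟨ conj-cong refl (inverseˡ x) ⟩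
    conj g ε                 ≈⟨ conj-ε g ⟩
    ε                        ∎)

  conj-conj : ∀ g a x → conj g (conj a x) ≈ conj (conj g a) (conj g x)
  conj-conj g a x = trans (conj-∙ g (a ∙ x) (a ⁻¹)) (∙-cong (conj-∙ g a x) (conj-⁻¹ g a))

  conj-pow : ∀ g x n → conj g (pow x n) ≈ pow (conj g x) n
  conj-pow g x zero    = conj-ε g
  conj-pow g x (suc n) = trans (conj-∙ g x (pow x n)) (∙-congˡ (conj-pow g x n))

  pow-conj-ε : ∀ g n → pow x n ≈ ε → pow (conj g x) n ≈ ε
  pow-conj-ε {x} g n xⁿ≈ε = trans (sym (conj-pow g x n)) (trans (conj-cong refl xⁿ≈ε) (conj-ε g))

  conj-inverts-cyclic : conj g w ≈ w ⁻¹ → ⟨ w ∷ [] ⟩ x → conj g x ≈ x ⁻¹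
  conj-inverts-cyclic gw≈w⁻¹ (gen (here x≈w)) = trans (conj-cong refl x≈w) (trans gw≈w⁻¹ (⁻¹-cong (sym x≈w)))
  conj-inverts-cyclic {g} gw≈w⁻¹ unit         = trans (conj-ε g) (sym ε⁻¹≈ε)
  conj-inverts-cyclic {g} gw≈w⁻¹ (mul {x} {y} x∈ y∈) = begin
    conj g (x ∙ y)          ≈⟨ conj-∙ g x y ⟩
    conj g x ∙ conj g y     ≈⟨ ∙-cong (conj-inverts-cyclic gw≈w⁻¹ x∈) (conj-inverts-cyclic gw≈w⁻¹ y∈) ⟩
    x ⁻¹ ∙ y ⁻¹             ≈⟨ ⁻¹-anti-homo-∙ y x ⟨
    (y ∙ x) ⁻¹              ≈⟨ ⁻¹-cong (⟨⟩-commute y∈ x∈) ⟩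
    (x ∙ y) ⁻¹              ∎
  conj-inverts-cyclic {g} gw≈w⁻¹ (inv {x} x∈) =
    trans (conj-⁻¹ g x) (⁻¹-cong (conj-inverts-cyclic gw≈w⁻¹ x∈))
  conj-inverts-cyclic gw≈w⁻¹ (resp x≈y x∈) =
    trans (conj-cong refl (sym x≈y)) (trans (conj-inverts-cyclic gw≈w⁻¹ x∈) (⁻¹-cong x≈y))

  conj-⁻¹≈conj⇒commute-square : ∀ a → conj (a ⁻¹) y ≈ conj a y → Commute (a ∙ a) y
  conj-⁻¹≈conj⇒commute-square {y} a eq = begin
    a ∙ a ∙ y                     ≈⟨ identityʳ _ ⟨
    a ∙ a ∙ y ∙ ε                 ≈⟨ ∙-congˡ (inverseˡ a) ⟨
    a ∙ a ∙ y ∙ (a ⁻¹ ∙ a)        ≈⟨ solve monoid ⟩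
    a ∙ (a ∙ y ∙ a ⁻¹) ∙ a        ≈⟨ ∙-congʳ (∙-congˡ eq) ⟨
    a ∙ (a ⁻¹ ∙ y ∙ a ⁻¹ ⁻¹) ∙ a  ≈⟨ ∙-congʳ (∙-congˡ (∙-congˡ (⁻¹-involutive a))) ⟩
    a ∙ (a ⁻¹ ∙ y ∙ a) ∙ a        ≈⟨ solve monoid ⟩
    (a ∙ a ⁻¹) ∙ y ∙ (a ∙ a)      ≈⟨ ∙-congʳ (∙-congʳ (inverseʳ a)) ⟩
    ε ∙ y ∙ (a ∙ a)               ≈⟨ ∙-congʳ (identityˡ y) ⟩
    y ∙ (a ∙ a)                   ∎

  inverts-conjugate⇒commute-square : ∀ a → conj g a ≈ a ⁻¹ → conj g x ≈ x ⁻¹ →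
    conj g (conj a x) ≈ conj a x ⁻¹ → Commute (a ∙ a) x
  inverts-conjugate⇒commute-square {g} {x} a ga≈a⁻¹ gx≈x⁻¹ gax≈ax⁻¹ =
    sym (commute-respˡ (⁻¹-involutive x) (commute-⁻¹ˡ (sym
      (conj-⁻¹≈conj⇒commute-square a (begin
        conj (a ⁻¹) (x ⁻¹)          ≈⟨ conj-cong ga≈a⁻¹ gx≈x⁻¹ ⟨
        conj (conj g a) (conj g x)  ≈⟨ conj-conj g a x ⟨
        conj g (conj a x)           ≈⟨ gax≈ax⁻¹ ⟩
        conj a x ⁻¹                 ≈⟨ conj-⁻¹ a x ⟨
        conj a (x ⁻¹)               ∎)))))

  commute-odd-order : ∀ a → ¬ (2 ∣ p) → pow a p ≈ ε → Commute (a ∙ a) z → Commute a z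
  commute-odd-order a ¬2∣p aᵖ≈ε a²z≈za² with ¬2∣⇒odd ¬2∣p
  ... | k , ≡.refl = commute-respˡ a²⁽ᵏ⁺¹⁾≈a (commute-powˡ (suc k) a²z≈za²)
    where
    a²⁽ᵏ⁺¹⁾≈a : pow (a ∙ a) (suc k) ≈ a
    a²⁽ᵏ⁺¹⁾≈a = begin
      pow (a ∙ a) (suc k)      ≈⟨ pow-cong (suc k) (∙-congˡ (identityʳ a)) ⟨
      pow (pow a 2) (suc k)    ≈⟨ pow-* a (suc k) 2 ⟩
      a ∙ pow a (suc (k * 2))  ≈⟨ ∙-congˡ aᵖ≈ε ⟩
      a ∙ ε                    ≈⟨ identityʳ a ⟩
      a                        ∎

  square-ε⇒self-inverse : pow x 2 ≈ ε → x ⁻¹ ≈ x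
  square-ε⇒self-inverse {x} x²≈ε = sym (inverseʳ-unique x x (trans (∙-congˡ (sym (identityʳ x))) x²≈ε))

  self-inverse-∙-⁻¹ : x ⁻¹ ≈ x → y ⁻¹ ≈ y → (x ∙ y) ⁻¹ ≈ y ∙ x
  self-inverse-∙-⁻¹ {x} {y} x⁻¹≈x y⁻¹≈y = trans (⁻¹-anti-homo-∙ x y) (∙-cong y⁻¹≈y x⁻¹≈x)

  conj-inverts-∙ˡ : x ⁻¹ ≈ x → y ⁻¹ ≈ y → conj x (y ∙ x) ≈ (y ∙ x) ⁻¹
  conj-inverts-∙ˡ {x} {y} x⁻¹≈x y⁻¹≈y = begin
    x ∙ (y ∙ x) ∙ x ⁻¹   ≈⟨ solve monoid ⟩
    x ∙ y ∙ (x ∙ x ⁻¹)   ≈⟨ ∙-congˡ (inverseʳ x) ⟩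
    x ∙ y ∙ ε            ≈⟨ identityʳ _ ⟩
    x ∙ y                ≈⟨ self-inverse-∙-⁻¹ y⁻¹≈y x⁻¹≈x ⟨
    (y ∙ x) ⁻¹           ∎

  conj-inverts-∙ʳ : x ⁻¹ ≈ x → y ⁻¹ ≈ y → conj x (x ∙ y) ≈ (x ∙ y) ⁻¹
  conj-inverts-∙ʳ {x} {y} x⁻¹≈x y⁻¹≈y = begin
    x ∙ (x ∙ y) ∙ x ⁻¹      ≈⟨ ∙-congʳ (∙-congʳ x⁻¹≈x) ⟨
    x ⁻¹ ∙ (x ∙ y) ∙ x ⁻¹   ≈⟨ solve monoid ⟩
    (x ⁻¹ ∙ x) ∙ y ∙ x ⁻¹   ≈⟨ ∙-congʳ (∙-congʳ (inverseˡ x)) ⟩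
    ε ∙ y ∙ x ⁻¹            ≈⟨ ∙-congʳ (identityˡ y) ⟩
    y ∙ x ⁻¹                ≈⟨ ∙-congʳ y⁻¹≈y ⟨
    y ⁻¹ ∙ x ⁻¹             ≈⟨ ⁻¹-anti-homo-∙ x y ⟨
    (x ∙ y) ⁻¹              ∎

module RegularPolyhedron {c ℓ} {G : Group c ℓ} {p q : ℕ} {ρ₀ ρ₁ ρ₂ : Group.Carrier G}
                         (P : GroupNotions.RegularPolyhedronGroup G p q ρ₀ ρ₁ ρ₂) where
  open Group G
  open GroupNotions G
  open GroupTheory G
  open RegularPolyhedronGroup P
  open import Relation.Binary.Reasoning.Setoid setoid

  a b ω : Carrier
  a = ρ₀ ∙ ρ₁
  b = ρ₁ ∙ ρ₂
  ω = pow b 2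

  ρ₀⁻¹≈ρ₀ : ρ₀ ⁻¹ ≈ ρ₀
  ρ₀⁻¹≈ρ₀ = square-ε⇒self-inverse (proj₁ (proj₂ ρ₀-invol))

  ρ₁⁻¹≈ρ₁ : ρ₁ ⁻¹ ≈ ρ₁
  ρ₁⁻¹≈ρ₁ = square-ε⇒self-inverse (proj₁ (proj₂ ρ₁-invol))

  ρ₂⁻¹≈ρ₂ : ρ₂ ⁻¹ ≈ ρ₂
  ρ₂⁻¹≈ρ₂ = square-ε⇒self-inverse (proj₁ (proj₂ ρ₂-invol))

  aᵖ≈ε : pow a p ≈ ε
  aᵖ≈ε = proj₁ (proj₂ order-ρ₀ρ₁)

  ρ₀ρ₂≈ρ₂ρ₀ : Commute ρ₀ ρ₂
  ρ₀ρ₂≈ρ₂ρ₀ = trans (sym (square-ε⇒self-inverse ρ₀ρ₂-square)) (self-inverse-∙-⁻¹ ρ₀⁻¹≈ρ₀ ρ₂⁻¹≈ρ₂)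

  ρ₁-inverts-a : conj ρ₁ a ≈ a ⁻¹
  ρ₁-inverts-a = conj-inverts-∙ˡ ρ₁⁻¹≈ρ₁ ρ₀⁻¹≈ρ₀

  ρ₁-inverts-⟨ω⟩ : ∀ {x} → ⟨ ω ∷ [] ⟩ x → conj ρ₁ x ≈ x ⁻¹
  ρ₁-inverts-⟨ω⟩ = conj-inverts-cyclic (conj-inverts-cyclic (conj-inverts-∙ʳ ρ₁⁻¹≈ρ₁ ρ₂⁻¹≈ρ₂) (pow-∈ 2))

  ωa≈conj-a : ω ∙ a ≈ conj b (conj ρ₁ a)
  ωa≈conj-a = sym (begin
    conj b (conj ρ₁ a)                   ≈⟨ conj-cong refl ρ₁-inverts-a ⟩
    b ∙ a ⁻¹ ∙ b ⁻¹                      ≈⟨ ∙-cong (∙-congˡ (self-inverse-∙-⁻¹ ρ₀⁻¹≈ρ₀ ρ₁⁻¹≈ρ₁))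
                                                   (self-inverse-∙-⁻¹ ρ₁⁻¹≈ρ₁ ρ₂⁻¹≈ρ₂) ⟩
    ρ₁ ∙ ρ₂ ∙ (ρ₁ ∙ ρ₀) ∙ (ρ₂ ∙ ρ₁)      ≈⟨ solve monoid ⟩
    ρ₁ ∙ ρ₂ ∙ ρ₁ ∙ (ρ₀ ∙ ρ₂) ∙ ρ₁        ≈⟨ ∙-congʳ (∙-congˡ ρ₀ρ₂≈ρ₂ρ₀) ⟩
    ρ₁ ∙ ρ₂ ∙ ρ₁ ∙ (ρ₂ ∙ ρ₀) ∙ ρ₁        ≈⟨ solve monoid ⟩
    ρ₁ ∙ ρ₂ ∙ (ρ₁ ∙ ρ₂ ∙ ε) ∙ (ρ₀ ∙ ρ₁)  ∎)

  ω-central : ¬ (2 ∣ p) → NormalIn ω (Γ⁺ ρ₀ ρ₁ ρ₂) → CentralIn ω (Γ⁺ ρ₀ ρ₁ ρ₂)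
  ω-central ¬2∣p normal h h∈Γ⁺ = commute-⟨⟩ˡ commutes-with-generators h∈Γ⁺
    where
    aω≈ωa : Commute a ω
    aω≈ωa = commute-odd-order a ¬2∣p aᵖ≈ε
      (inverts-conjugate⇒commute-square a ρ₁-inverts-a (ρ₁-inverts-⟨ω⟩ (gen (here refl)))
        (ρ₁-inverts-⟨ω⟩ (normal a ω (gen (here refl)) (gen (here refl)))))

    commutes-with-generators : ∀ {y} → Any (y ≈_) (a ∷ b ∷ []) → Commute y ω
    commutes-with-generators (here y≈a)         = commute-respˡ (sym y≈a) aω≈ωa
    commutes-with-generators (there (here y≈b)) = commute-respˡ (sym y≈b) (sym (commute-powˡ 2 refl))

  ω-central⇒q∣2p : CentralIn ω (Γ⁺ ρ₀ ρ₁ ρ₂) → q ∣ 2 * p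
  ω-central⇒q∣2p central = ≡.subst (q ∣_) (*-comm p 2) (order-∣ order-ρ₁ρ₂ b²ᵖ≈ε)
    where
    ωᵖ≈ε : pow ω p ≈ ε
    ωᵖ≈ε = begin
      pow ω p                     ≈⟨ identityʳ _ ⟨
      pow ω p ∙ ε                 ≈⟨ ∙-congˡ aᵖ≈ε ⟨
      pow ω p ∙ pow a p           ≈⟨ pow-∙ p (sym (central a (gen (here refl)))) ⟨
      pow (ω ∙ a) p               ≈⟨ pow-cong p ωa≈conj-a ⟩
      pow (conj b (conj ρ₁ a)) p  ≈⟨ pow-conj-ε b p (pow-conj-ε ρ₁ p aᵖ≈ε) ⟩
      ε                           ∎

    b²ᵖ≈ε : pow b (p * 2) ≈ ε
    b²ᵖ≈ε = trans (sym (pow-* b p 2)) ωᵖ≈ε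

-- Orientability (the index-2 hypothesis) is not needed for this argument.
lemma3p2 : ∀ {c ℓ} (Γ : Group c ℓ) (p q : ℕ) (ρ₀ ρ₁ ρ₂ : Group.Carrier Γ) →
    GroupNotions.RegularPolyhedronGroup Γ p q ρ₀ ρ₁ ρ₂ →
    GroupNotions.Index2 Γ (GroupNotions.Γ⁺ Γ ρ₀ ρ₁ ρ₂) →
    ¬ (2 ∣ p) →
    GroupNotions.NormalIn Γ (GroupNotions.pow Γ (Group._∙_ Γ ρ₁ ρ₂) 2) (GroupNotions.Γ⁺ Γ ρ₀ ρ₁ ρ₂) →
    GroupNotions.CentralIn Γ (GroupNotions.pow Γ (Group._∙_ Γ ρ₁ ρ₂) 2) (GroupNotions.Γ⁺ Γ ρ₀ ρ₁ ρ₂)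
      × (q ∣ 2 * p)
lemma3p2 Γ p q ρ₀ ρ₁ ρ₂ P _ ¬2∣p normal = ω-central ¬2∣p normal , ω-central⇒q∣2p (ω-central ¬2∣p normal)
  where open RegularPolyhedron P
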